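{- If $G$ is a connected graph with at least two vertices, then $$\mathrm{def}_c(\widehat{G})\ge \frac{|E(G)|-1}{4(\mathrm{diam}(G)+2)}-\Delta(G)+1.$$
   Context: All graphs are finite, simple and undirected. For a graph $G$ with $V(G)=\{v_1,\dots,v_n\}$, $S(G)$ is the graph obtained by subdividing every edge: $V(S(G))=V(G)\cup\{w_{ij}:v_iv_j\in E(G)\}$ and $E(S(G))=\{v_iw_{ij},v_jw_{ij}:v_iv_j\in E(G)\}$. The graph $\widehat{G}$ is obtained from $S(G)$ by adding a new vertex $u$ and the edges $uw_{ij}$ for all $v_iv_j\in E(G)$. $\mathrm{diam}(G)$ is the diameter and $\Delta(G)$ the maximum degree. A set $A\subseteq\{1,\dots,t\}$ is a cyclic interval modulo $t$ if $A$ or $\{1,\dots,t\}\setminus A$ is an interval of integers; a cyclic interval $t$-coloring is a proper edge coloring with colors $1,\dots,t$ in which the set of colors at every vertex is a cyclic interval modulo $t$. The cyclic deficiency $\mathrm{def}_c(H)$ of a graph $H$ is the minimum number of pendant edges whose attachment to $H$ yields a graph admitting a cyclic interval coloring (equivalently, the minimum over proper edge colorings $\alpha$ of $H$, with any number $t$ of colors, of the sum over vertices $v$ of the minimum number of positive integers that must be added to the color set at $v$ to make it a cyclic interval modulo $t$). -}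

module Defs where

open import Data.Nat using (ℕ; zero; suc; _+_; _*_; _∸_; _≤_; _<_; _⊔_)
open import Data.Fin using (Fin; _↑ˡ_; _↑ʳ_; _≟_)
import Data.Fin as F
open import Data.List using (List; []; _∷_; length; lookup; tabulate; concat; map; foldr)
open import Data.Nat.ListAction using (sum)
open import Data.List.Membership.Propositional using (_∈_; _∉_)
open import Data.List.Relation.Unary.Unique.Propositional using (Unique)
open import Data.Product using (Σ; ∃; ∃-syntax; _×_; _,_; proj₁; proj₂)
open import Data.Sum using (_⊎_)
open import Relation.Nullary using (¬_; does)
open import Relation.Binary.PropositionalEquality using (_≡_; _≢_)
open import Data.Bool using (if_then_else_; _∨_)

-- Graphs given by a vertex count and a list of edges (unordered pairs
-- stored as ordered pairs).  Edges are indexed by Fin (length edges).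

record RawGraph : Set where
  field
    order : ℕ
    edges : List (Fin order × Fin order)

open RawGraph public

Edge : RawGraph → Set
Edge H = Fin (length (edges H))

ends : (H : RawGraph) → Edge H → Fin (order H) × Fin (order H)
ends H e = lookup (edges H) e

Incident : (H : RawGraph) → Edge H → Fin (order H) → Set
Incident H e v = proj₁ (ends H e) ≡ v ⊎ proj₂ (ends H e) ≡ v

Simple : RawGraph → Set
Simple H =
  (∀ (e : Edge H) → proj₁ (ends H e) ≢ proj₂ (ends H e)) ×
  (∀ (e e' : Edge H) → e ≢ e' →
     ¬ ((Incident H e (proj₁ (ends H e')) × Incident H e (proj₂ (ends H e')))))

Adj : (H : RawGraph) → Fin (order H) → Fin (order H) → Set
Adj H x y = ((x , y) ∈ edges H) ⊎ ((y , x) ∈ edges H)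

data Walk (H : RawGraph) : Fin (order H) → Fin (order H) → ℕ → Set where
  nil  : ∀ {x} → Walk H x x 0
  cons : ∀ {x y z k} → Adj H x y → Walk H y z k → Walk H x z (suc k)

Connected : RawGraph → Set
Connected H = ∀ (x y : Fin (order H)) → ∃[ k ] Walk H x y k

IsDiameter : RawGraph → ℕ → Set
IsDiameter H D =
  (∀ (x y : Fin (order H)) → ∃[ k ] (k ≤ D × Walk H x y k)) ×
  (∃[ x ] ∃[ y ] ∀ k → Walk H x y k → D ≤ k)

degree : (H : RawGraph) → Fin (order H) → ℕ
degree H v = sum (map (λ p → if does (proj₁ p ≟ v) ∨ does (proj₂ p ≟ v) then 1 else 0) (edges H))

maxDegree : RawGraph → ℕ
maxDegree H = foldr _⊔_ 0 (tabulate (degree H))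

-- The graph Ĝ: vertices v_1..v_n (indices 0..n-1), w_e for each edge e
-- (indices n..n+m-1), and u (index n+m).  Edges v_i w_e, v_j w_e, u w_e
-- for each edge e = v_i v_j of G.

hat : RawGraph → RawGraph
hat G = record { order = n + suc m ; edges = concat (tabulate es) }
  where
  n = order G
  m = length (edges G)
  vv : Fin n → Fin (n + suc m)
  vv i = i ↑ˡ suc m
  ww : Fin m → Fin (n + suc m)
  ww k = n ↑ʳ F.inject₁ k
  uu : Fin (n + suc m)
  uu = n ↑ʳ F.fromℕ m
  es : Fin m → List (Fin (n + suc m) × Fin (n + suc m))
  es k = (vv (proj₁ (lookup (edges G) k)) , ww k)
       ∷ (vv (proj₂ (lookup (edges G) k)) , ww k)
       ∷ (uu , ww k) ∷ []

IsInterval : (ℕ → Set) → Set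
IsInterval A = ∃[ a ] ∃[ b ] ∀ x → (A x → a ≤ x × x ≤ b) × (a ≤ x × x ≤ b → A x)

IsCyclicInterval : ℕ → (ℕ → Set) → Set
IsCyclicInterval t A =
  (∀ x → A x → 1 ≤ x × x ≤ t) ×
  (IsInterval A ⊎ IsInterval (λ x → (1 ≤ x × x ≤ t) × ¬ A x))

IsProperColoring : (H : RawGraph) → ℕ → (Edge H → ℕ) → Set
IsProperColoring H t α =
  (∀ e → 1 ≤ α e × α e ≤ t) ×
  (∀ e e' v → e ≢ e' → Incident H e v → Incident H e' v → α e ≢ α e')

ColorAt : (H : RawGraph) → (Edge H → ℕ) → Fin (order H) → ℕ → Set
ColorAt H α v c = ∃[ e ] (Incident H e v × α e ≡ c)

GoodAddition : (H : RawGraph) → ℕ → (Edge H → ℕ) → Fin (order H) → List ℕ → Set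
GoodAddition H t α v D =
  Unique D × (∀ x → x ∈ D → 1 ≤ x × ¬ ColorAt H α v x) ×
  IsCyclicInterval t (λ x → ColorAt H α v x ⊎ x ∈ D)

IsVertexDeficiency : (H : RawGraph) → ℕ → (Edge H → ℕ) → Fin (order H) → ℕ → Set
IsVertexDeficiency H t α v k =
  (∃[ D ] (GoodAddition H t α v D × length D ≡ k)) ×
  (∀ D → GoodAddition H t α v D → k ≤ length D)

IsColoringDeficiency : (H : RawGraph) → ℕ → (Edge H → ℕ) → ℕ → Set
IsColoringDeficiency H t α s =
  ∃[ ks ] ((∀ v → IsVertexDeficiency H t α v (ks v)) × sum (tabulate ks) ≡ s)

IsCyclicDeficiency : RawGraph → ℕ → Set
IsCyclicDeficiency H d =
  (∃[ t ] ∃[ α ] (IsProperColoring H t α × IsColoringDeficiency H t α d)) ×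
  (∀ t α s → IsProperColoring H t α → IsColoringDeficiency H t α s → d ≤ s)

-- Fix a proper t-colouring α of Ĝ of deficiency d, so that at most d integers are added at each
-- vertex. The m edges u w_e meet at u and carry distinct colours. At a vertex v_x the at most Δ
-- colours together with the added integers form a cyclic interval, so any two colours there are at
-- cyclic distance (modulo t) at most Δ + d − 1; at a vertex w_e the bound is 2 + d. Two edges
-- u w_e and u w_f are linked through w_e, a walk of length at most D in G and w_f, so all colours
-- at u lie within cyclic distance R = (D + 1)(Δ + d − 1) + (D + 2)(2 + d) of one of them, whence
-- m ≤ 2R + 2, which is the bound when Δ ≥ 3. When Δ ≤ 2 we show m ≤ (D + 1)Δ directly: every edge
-- is the last step of a non-backtracking walk of length at most D + 1 from a fixed vertex, and
-- when Δ ≤ 2 such a walk is determined by its length and its first edge.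
module Submission where

open import Defs
open import Function using (_∘_)
open import Data.Nat using (ℕ; zero; suc; _+_; _*_; _∸_; _≤_; _<_; z≤n; s≤s; s≤s⁻¹; _⊔_; _≤?_)
open import Data.Nat.Properties hiding (_≟_)
import Data.Nat.Divisibility as ℕ
open import Data.Nat.ListAction using (sum)
open import Data.Nat.Tactic.RingSolver using (solve-∀)
open import Data.Integer as ℤ using (ℤ; +_; -_; ∣_∣; 0ℤ)
import Data.Integer.Properties as ℤ
open import Data.Integer.Divisibility.Signed using (_∣_; divides; ∣m∣n⇒∣m+n; ∣m⇒∣-m; ∣m∣n⇒∣m-n; ∣-refl; ∣⇒∣ᵤ)
import Data.Integer.Tactic.RingSolver as ℤ
open import Data.Bool using (true; false; if_then_else_; _∨_)
open import Data.Fin using (Fin; zero; suc; toℕ; fromℕ<; _↑ˡ_; _↑ʳ_; _≟_; splitAt)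
open import Data.Fin.Patterns using (0F; 1F; 2F)
import Data.Fin as Fin
import Data.Fin.Properties as Fin
open import Data.List using (List; []; _∷_; length; lookup; map; foldr; tabulate; concat; _++_; applyUpTo; upTo; cartesianProduct)
open import Data.List.Properties using (length-map; length-++; length-tabulate; length-applyUpTo; length-upTo)
open import Data.List.Membership.Propositional using (_∈_)
open import Data.List.Membership.Propositional.Properties
  using (∈-lookup; ∈-map⁺; ∈-++⁺ˡ; ∈-++⁺ʳ; ∈-++⁻; ∈-tabulate⁺; ∈-tabulate⁻; ∈-applyUpTo⁺; ∈-applyUpTo⁻; ∈-upTo⁺; ∈-cartesianProduct⁺)
open import Data.List.Membership.DecPropositional Data.Nat._≟_ using (_∈?_)
open import Data.List.Relation.Binary.Subset.Propositional using (_⊆_)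
open import Data.List.Relation.Unary.Any using (here; there; index)
open import Data.List.Relation.Unary.Any.Properties using (lookup-index)
open import Data.List.Relation.Unary.All using ([]; _∷_)
import Data.List.Relation.Unary.All as All
open import Data.List.Relation.Unary.AllPairs using ([]; _∷_)
open import Data.List.Relation.Unary.Unique.Propositional using (Unique)
import Data.List.Relation.Unary.Unique.Propositional.Properties as Unique
open import Data.Product using (Σ-syntax; ∃-syntax; _×_; _,_; proj₁; proj₂)
import Data.Product as Product
open import Data.Sum using (_⊎_; inj₁; inj₂)
open import Relation.Binary.PropositionalEquality
open import Relation.Nullary using (¬_; Dec; yes; no; does; contradiction)
open import Relation.Nullary.Decidable using (decidable-stable)

module _ {A : Set} where

  Unique⇒lookup-injective : ∀ {xs : List A} → Unique xs → ∀ {i j} → lookup xs i ≡ lookup xs j → i ≡ j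
  Unique⇒lookup-injective (_  ∷ _) {zero}  {zero}  _  = refl
  Unique⇒lookup-injective (x∉ ∷ _) {zero}  {suc j} eq = contradiction eq (All.lookup x∉ (∈-lookup j))
  Unique⇒lookup-injective (x∉ ∷ _) {suc i} {zero}  eq = contradiction (sym eq) (All.lookup x∉ (∈-lookup i))
  Unique⇒lookup-injective (_  ∷ u) {suc i} {suc j} eq = cong suc (Unique⇒lookup-injective u eq)

  Unique-⊆⇒length≤ : ∀ {xs ys : List A} → Unique xs → xs ⊆ ys → length xs ≤ length ys
  Unique-⊆⇒length≤ {xs} {ys} u xs⊆ys = Fin.injective⇒≤ λ {i} {j} eq → Unique⇒lookup-injective u (begin
    lookup xs i                            ≡⟨ lookup-index (xs⊆ys (∈-lookup i)) ⟩
    lookup ys (index (xs⊆ys (∈-lookup i))) ≡⟨ cong (lookup ys) eq ⟩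
    lookup ys (index (xs⊆ys (∈-lookup j))) ≡⟨ lookup-index (xs⊆ys (∈-lookup j)) ⟨
    lookup xs j                            ∎)
    where open ≡-Reasoning

length-cartesianProduct : ∀ {A B : Set} (xs : List A) (ys : List B) →
  length (cartesianProduct xs ys) ≡ length xs * length ys
length-cartesianProduct []       ys = refl
length-cartesianProduct (x ∷ xs) ys = begin
  length (map (x ,_) ys ++ cartesianProduct xs ys)         ≡⟨ length-++ (map (x ,_) ys) ⟩
  length (map (x ,_) ys) + length (cartesianProduct xs ys)
    ≡⟨ cong₂ _+_ (length-map (x ,_) ys) (length-cartesianProduct xs ys) ⟩
  length ys + length xs * length ys                        ∎
  where open ≡-Reasoning

∈⇒≤sum : ∀ {n ns} → n ∈ ns → n ≤ sum ns
∈⇒≤sum {ns = n ∷ ns} (here refl)  = m≤m+n n (sum ns)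
∈⇒≤sum {ns = m ∷ ns} (there n∈ns) = ≤-trans (∈⇒≤sum n∈ns) (m≤n+m (sum ns) m)

∈⇒≤foldr-⊔ : ∀ {n ns} → n ∈ ns → n ≤ foldr _⊔_ 0 ns
∈⇒≤foldr-⊔ {ns = n ∷ ns} (here refl)  = m≤m⊔n n _
∈⇒≤foldr-⊔ {ns = m ∷ ns} (there n∈ns) = ≤-trans (∈⇒≤foldr-⊔ n∈ns) (m≤n⊔m m _)

runs-⊆⇒length≤ : ∀ {x y k l} {ns : List ℕ} → x + k ≤ y →
  (∀ {i} → i < k → x + i ∈ ns) → (∀ {i} → i < l → y + i ∈ ns) → k + l ≤ length ns
runs-⊆⇒length≤ {x} {y} {k} {l} {ns} x+k≤y first second = begin
  k + l                                ≡⟨ cong₂ _+_ (length-applyUpTo (_+_ x) k) (length-applyUpTo (_+_ y) l) ⟨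
  length (run x k) + length (run y l)  ≡⟨ length-++ (run x k) ⟨
  length (run x k ++ run y l)
    ≤⟨ Unique-⊆⇒length≤ (Unique.++⁺ (run-unique x k) (run-unique y l) disjoint) ⊆ns ⟩
  length ns                            ∎
  where
  open ≤-Reasoning
  run : ℕ → ℕ → List ℕ
  run s = applyUpTo (_+_ s)
  run-unique : ∀ s k → Unique (run s k)
  run-unique s k = Unique.applyUpTo⁺₁ (_+_ s) k (λ i<j _ → <⇒≢ (+-monoʳ-< s i<j))
  disjoint : ∀ {z} → ¬ (z ∈ run x k × z ∈ run y l)
  disjoint (p , q) with ∈-applyUpTo⁻ (_+_ x) p | ∈-applyUpTo⁻ (_+_ y) q
  ... | i , i<k , refl | j , _ , eq = <⇒≢ (<-≤-trans (+-monoʳ-< x i<k) (≤-trans x+k≤y (m≤m+n y j))) eq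
  ⊆ns : run x k ++ run y l ⊆ ns
  ⊆ns z∈ with ∈-++⁻ (run x k) z∈
  ... | inj₁ p = let i , i<k , eq = ∈-applyUpTo⁻ (_+_ x) p in subst (_∈ ns) (sym eq) (first i<k)
  ... | inj₂ q = let j , j<l , eq = ∈-applyUpTo⁻ (_+_ y) q in subst (_∈ ns) (sym eq) (second j<l)

run-⊆⇒length≤ : ∀ {x k} {ns : List ℕ} → (∀ {i} → i < k → x + i ∈ ns) → k ≤ length ns
run-⊆⇒length≤ {x} {k} run⊆ns =
  subst (_≤ _) (+-identityʳ k) (runs-⊆⇒length≤ {x} {x + k} {l = 0} ≤-refl run⊆ns λ ())

-- Cyclic distance modulo t

record Near (t k x y : ℕ) : Set where
  constructor near
  field
    offset    : ℤ
    offset≤   : ∣ offset ∣ ≤ k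
    congruent : + t ∣ + x ℤ.- + y ℤ.- offset

near-mono : ∀ {t k l x y} → k ≤ l → Near t k x y → Near t l x y
near-mono k≤l (near a ∣a∣≤k t∣) = near a (≤-trans ∣a∣≤k k≤l) t∣

near-sym : ∀ {t k x y} → Near t k x y → Near t k y x
near-sym {x = x} {y} (near a ∣a∣≤k t∣) =
  near (- a) (subst (_≤ _) (sym (ℤ.∣-i∣≡∣i∣ a)) ∣a∣≤k)
    (subst (_ ∣_) (negate (+ x) (+ y) a) (∣m⇒∣-m t∣))
  where
  negate : ∀ x y a → - (x ℤ.- y ℤ.- a) ≡ y ℤ.- x ℤ.- - a
  negate = ℤ.solve-∀

near-trans : ∀ {t k l x y z} → Near t k x y → Near t l y z → Near t (k + l) x z
near-trans {x = x} {y} {z} (near a ∣a∣≤k t∣) (near b ∣b∣≤l t∣′) =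
  near (a ℤ.+ b) (≤-trans (ℤ.∣i+j∣≤∣i∣+∣j∣ a b) (+-mono-≤ ∣a∣≤k ∣b∣≤l))
    (subst (_ ∣_) (telescope (+ x) (+ y) (+ z) a b) (∣m∣n⇒∣m+n t∣ t∣′))
  where
  telescope : ∀ x y z a b → (x ℤ.- y ℤ.- a) ℤ.+ (y ℤ.- z ℤ.- b) ≡ x ℤ.- z ℤ.- (a ℤ.+ b)
  telescope = ℤ.solve-∀

near-≤ : ∀ {t x y} → x ≤ y → Near t (y ∸ x) x y
near-≤ {t} {x} {y} x≤y =
  near (+ x ℤ.- + y) ∣x-y∣≤ (subst (+ t ∣_) (sym (ℤ.+-inverseʳ (+ x ℤ.- + y))) (divides 0ℤ refl))
  where
  ∣x-y∣≤ : ∣ + x ℤ.- + y ∣ ≤ y ∸ x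
  ∣x-y∣≤ = ≤-reflexive (trans (cong ∣_∣ (ℤ.m-n≡m⊖n x y)) (ℤ.∣⊖∣-≤ x≤y))

near-period : ∀ {t x} → Near t 0 (x + t) x
near-period {t} {x} = near 0ℤ z≤n (subst (+ t ∣_) (sym period) ∣-refl)
  where
  shift : ∀ x t → x ℤ.+ t ℤ.- x ℤ.- 0ℤ ≡ t
  shift = ℤ.solve-∀
  period : + (x + t) ℤ.- + x ℤ.- 0ℤ ≡ + t
  period = trans (cong (λ z → z ℤ.- + x ℤ.- 0ℤ) (ℤ.pos-+ x t)) (shift (+ x) (+ t))

∣∧<⇒≡0 : ∀ {m n} → m ℕ.∣ n → n < m → n ≡ 0
∣∧<⇒≡0 {n = zero}  _   _   = refl
∣∧<⇒≡0 {n = suc n} m∣n n<m = contradiction m∣n (ℕ.>⇒∤ n<m)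

congruent⇒≡ : ∀ {t x y} → 1 ≤ x → x ≤ t → 1 ≤ y → y ≤ t → + t ∣ + x ℤ.- + y → x ≡ y
congruent⇒≡ {t} {suc x} {suc y} _ x<t _ y<t t∣x-y =
  ℤ.+-injective (ℤ.i-j≡0⇒i≡j _ _ (ℤ.∣i∣≡0⇒i≡0 (∣∧<⇒≡0 (∣⇒∣ᵤ t∣x-y) ∣x-y∣<t)))
  where
  ∣x-y∣<t : ∣ + suc x ℤ.- + suc y ∣ < t
  ∣x-y∣<t = begin-strict
    ∣ + suc x ℤ.- + suc y ∣ ≡⟨ cong ∣_∣ (trans (ℤ.m-n≡m⊖n (suc x) (suc y)) (ℤ.[1+m]⊖[1+n]≡m⊖n x y)) ⟩
    ∣ x ℤ.⊖ y ∣              ≤⟨ ℤ.∣m⊝n∣≤m⊔n x y ⟩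
    x ⊔ y                    <⟨ ⊔-lub x<t y<t ⟩
    t                        ∎
    where open ≤-Reasoning

integersWithin : ℕ → List ℤ
integersWithin R = map (λ i → - + i) (upTo (suc R)) ++ map +_ (upTo (suc R))

∈-integersWithin : ∀ {R a} → ∣ a ∣ ≤ R → a ∈ integersWithin R
∈-integersWithin {R} {a} ∣a∣≤R with ℤ.+∣i∣≡i⊎+∣i∣≡-i a
... | inj₁ +∣a∣≡a  = ∈-++⁺ʳ (map (λ i → - + i) (upTo (suc R)))
  (subst (_∈ map +_ (upTo (suc R))) +∣a∣≡a (∈-map⁺ +_ (∈-upTo⁺ (s≤s ∣a∣≤R))))
... | inj₂ +∣a∣≡-a = ∈-++⁺ˡ
  (subst (_∈ map (λ i → - + i) (upTo (suc R))) (trans (cong -_ +∣a∣≡-a) (ℤ.neg-involutive a))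
    (∈-map⁺ (λ i → - + i) (∈-upTo⁺ (s≤s ∣a∣≤R))))

length-integersWithin : ∀ R → length (integersWithin R) ≡ 2 * suc R
length-integersWithin R = begin
  length (map (λ i → - + i) (upTo (suc R)) ++ map +_ (upTo (suc R)))
    ≡⟨ length-++ (map (λ i → - + i) (upTo (suc R))) ⟩
  length (map (λ i → - + i) (upTo (suc R))) + length (map +_ (upTo (suc R)))
    ≡⟨ cong₂ _+_ (length-map _ (upTo (suc R))) (length-map _ (upTo (suc R))) ⟩
  length (upTo (suc R)) + length (upTo (suc R))
    ≡⟨ cong₂ _+_ (length-upTo (suc R)) (trans (length-upTo (suc R)) (sym (+-identityʳ (suc R)))) ⟩
  2 * suc R ∎
  where open ≡-Reasoning

-- Distinct colours in 1..t that are congruent to c₀ plus the same offset coincide, so the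
-- offsets of distinct colours near c₀ are distinct integers in [-R, R].
near-distinct≤ : ∀ {t R c₀ m} (c : Fin m → ℕ) → (∀ i → 1 ≤ c i × c i ≤ t) →
  (∀ {i j} → c i ≡ c j → i ≡ j) → (∀ i → Near t R c₀ (c i)) → m ≤ 2 * suc R
near-distinct≤ {t} {R} {c₀} {m} c in-range c-injective near-c₀ = begin
  m                          ≡⟨ length-tabulate offset ⟨
  length (tabulate offset)   ≤⟨ Unique-⊆⇒length≤ (Unique.tabulate⁺ offset-injective) ⊆integersWithin ⟩
  length (integersWithin R)  ≡⟨ length-integersWithin R ⟩
  2 * suc R                  ∎
  where
  open ≤-Reasoning
  offset : Fin m → ℤ
  offset i = Near.offset (near-c₀ i)
  offset-injective : ∀ {i j} → offset i ≡ offset j → i ≡ j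
  offset-injective {i} {j} eq =
    c-injective (congruent⇒≡ (proj₁ (in-range i)) (proj₂ (in-range i))
                             (proj₁ (in-range j)) (proj₂ (in-range j)) t∣ci-cj)
    where
    cancel : ∀ c₀ x y a → (c₀ ℤ.- y ℤ.- a) ℤ.- (c₀ ℤ.- x ℤ.- a) ≡ x ℤ.- y
    cancel = ℤ.solve-∀
    t∣ci-cj : + t ∣ + c i ℤ.- + c j
    t∣ci-cj = subst (+ t ∣_) (cancel (+ c₀) (+ c i) (+ c j) (offset i))
      (∣m∣n⇒∣m-n (subst (λ a → + t ∣ + c₀ ℤ.- + c j ℤ.- a) (sym eq) (Near.congruent (near-c₀ j)))
                 (Near.congruent (near-c₀ i)))
  ⊆integersWithin : ∀ {a} → a ∈ tabulate offset → a ∈ integersWithin R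
  ⊆integersWithin a∈ with i , refl ← ∈-tabulate⁻ a∈ = ∈-integersWithin (Near.offset≤ (near-c₀ i))

module _ {t : ℕ} {L : List ℕ} where

  near-of-covered-run : ∀ {x y} → x ≤ y → (∀ {z} → x ≤ z → z ≤ y → z ∈ L) → Near t (length L ∸ 1) x y
  near-of-covered-run {x} {y} x≤y covered = near-mono (∸-monoˡ-≤ 1 run≤) (near-≤ x≤y)
    where
    run≤ : suc (y ∸ x) ≤ length L
    run≤ = run-⊆⇒length≤ λ {i} i≤y∸x → covered (m≤m+n x i)
      (≤-trans (+-monoʳ-≤ x (s≤s⁻¹ i≤y∸x)) (≤-reflexive (m+[n∸m]≡n x≤y)))

  near-of-covered-wrap : ∀ {x y} → x < y → y ≤ t →
    (∀ {z} → 1 ≤ z → z ≤ x → z ∈ L) → (∀ {z} → y ≤ z → z ≤ t → z ∈ L) → Near t (length L ∸ 1) x y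
  near-of-covered-wrap {x} {y} x<y y≤t low high =
    near-mono (≤-trans (≤-reflexive (trans (+-identityʳ _) (+-∸-assoc x y≤t))) (∸-monoˡ-≤ 1 runs≤))
      (near-sym (near-trans (near-≤ (≤-trans y≤t (m≤n+m t x))) near-period))
    where
    runs≤ : suc (x + (t ∸ y)) ≤ length L
    runs≤ = subst (_≤ length L) (+-suc x (t ∸ y))
      (runs-⊆⇒length≤ {1} {y} x<y (λ i<x → low (s≤s z≤n) i<x)
        (λ {i} i≤t∸y → high (m≤m+n y i)
          (≤-trans (+-monoʳ-≤ y (s≤s⁻¹ i≤t∸y)) (≤-reflexive (m+[n∸m]≡n y≤t)))))

  private
    near-ordered : ∀ {A x y} → IsCyclicInterval t A → (∀ {z} → A z → z ∈ L) → A x → A y → x ≤ y →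
      Near t (length L ∸ 1) x y
    near-ordered {A} {x} {y} (_ , inj₁ (a , b , interval)) cover Ax Ay x≤y =
      near-of-covered-run x≤y λ {z} x≤z z≤y → cover (proj₂ (interval z)
        (≤-trans (proj₁ (proj₁ (interval x) Ax)) x≤z , ≤-trans z≤y (proj₂ (proj₁ (interval y) Ay))))
    near-ordered {A} {x} {y} (in-range , inj₂ (a , b , gap)) cover Ax Ay x≤y = split (x ≤? b) (a ≤? y)
      where
      1≤x = proj₁ (in-range x Ax)
      y≤t = proj₂ (in-range y Ay)
      A⇒outside : ∀ {z} → A z → ¬ (a ≤ z × z ≤ b)
      A⇒outside Az in-gap = proj₂ (proj₂ (gap _) in-gap) Az
      -- constructive because membership in L is decidable
      outside-gap : ∀ {z} → 1 ≤ z → z ≤ t → ¬ (a ≤ z × z ≤ b) → z ∈ L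
      outside-gap {z} 1≤z z≤t z∉gap with z ∈? L
      ... | yes z∈L = z∈L
      ... | no  z∉L = contradiction (proj₁ (gap z) ((1≤z , z≤t) , λ Az → z∉L (cover Az))) z∉gap
      split : Dec (x ≤ b) → Dec (a ≤ y) → Near t (length L ∸ 1) x y
      split (no x≰b) _ = near-of-covered-run x≤y λ x≤z z≤y →
        outside-gap (≤-trans 1≤x x≤z) (≤-trans z≤y y≤t) (λ (_ , z≤b) → x≰b (≤-trans x≤z z≤b))
      split (yes _) (no a≰y) = near-of-covered-run x≤y λ x≤z z≤y →
        outside-gap (≤-trans 1≤x x≤z) (≤-trans z≤y y≤t) (λ (a≤z , _) → a≰y (≤-trans a≤z z≤y))
      split (yes x≤b) (yes a≤y) = near-of-covered-wrap (<-≤-trans x<a a≤y) y≤t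
        (λ 1≤z z≤x → outside-gap 1≤z (≤-trans z≤x (≤-trans x≤y y≤t))
                       (λ (a≤z , _) → <⇒≱ x<a (≤-trans a≤z z≤x)))
        (λ y≤z z≤t → outside-gap (≤-trans 1≤x (≤-trans x≤y y≤z)) z≤t
                       (λ (_ , z≤b) → <⇒≱ b<y (≤-trans y≤z z≤b)))
        where
        x<a : x < a
        x<a = ≰⇒> λ a≤x → A⇒outside Ax (a≤x , x≤b)
        b<y : b < y
        b<y = ≰⇒> λ y≤b → A⇒outside Ay (a≤y , y≤b)

  cyclicInterval⇒near : ∀ {A x y} → IsCyclicInterval t A → (∀ {z} → A z → z ∈ L) → A x → A y →
    Near t (length L ∸ 1) x y
  cyclicInterval⇒near {x = x} {y} cyclic cover Ax Ay with ≤-total x y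
  ... | inj₁ x≤y = near-ordered cyclic cover Ax Ay x≤y
  ... | inj₂ y≤x = near-sym (near-ordered cyclic cover Ay Ax y≤x)

near-at-vertex : ∀ {H t α v k e f} (Es : List (Edge H)) → (∀ {e} → Incident H e v → e ∈ Es) →
  IsVertexDeficiency H t α v k → Incident H e v → Incident H f v → Near t (length Es + k ∸ 1) (α e) (α f)
near-at-vertex {H} {t} {α} {v} {e = e} {f} Es Es-covers ((D , (_ , _ , cyclic) , length-D) , _) e∋v f∋v =
  subst (λ l → Near t (l ∸ 1) (α e) (α f)) (trans (length-++ (map α Es)) (cong₂ _+_ (length-map α Es) length-D))
    (cyclicInterval⇒near cyclic cover (inj₁ (e , e∋v , refl)) (inj₁ (f , f∋v , refl)))
  where
  cover : ∀ {c} → ColorAt H α v c ⊎ c ∈ D → c ∈ map α Es ++ D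
  cover (inj₁ (e , e∋v , refl)) = ∈-++⁺ˡ (∈-map⁺ α (Es-covers e∋v))
  cover (inj₂ c∈D)              = ∈-++⁺ʳ (map α Es) c∈D

src tgt : (G : RawGraph) → Edge G → Fin (order G)
src G e = proj₁ (ends G e)
tgt G e = proj₂ (ends G e)

Joins : (G : RawGraph) → Edge G → Fin (order G) → Fin (order G) → Set
Joins G e x y = (src G e ≡ x × tgt G e ≡ y) ⊎ (src G e ≡ y × tgt G e ≡ x)

incidentEdges : ∀ {n} (es : List (Fin n × Fin n)) → Fin n → List (Fin (length es))
incidentEdges []       v = []
incidentEdges (p ∷ ps) v =
  if does (proj₁ p ≟ v) ∨ does (proj₂ p ≟ v) then zero ∷ map suc (incidentEdges ps v) else map suc (incidentEdges ps v)

module _ {n : ℕ} where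

  length-incidentEdges : ∀ (es : List (Fin n × Fin n)) v →
    length (incidentEdges es v) ≡ sum (map (λ p → if does (proj₁ p ≟ v) ∨ does (proj₂ p ≟ v) then 1 else 0) es)
  length-incidentEdges []       v = refl
  length-incidentEdges (p ∷ ps) v with does (proj₁ p ≟ v) ∨ does (proj₂ p ≟ v)
  ... | true  = cong suc (trans (length-map suc (incidentEdges ps v)) (length-incidentEdges ps v))
  ... | false = trans (length-map suc (incidentEdges ps v)) (length-incidentEdges ps v)

  ∈-incidentEdges : ∀ (es : List (Fin n × Fin n)) {v} (e : Fin (length es)) →
    proj₁ (lookup es e) ≡ v ⊎ proj₂ (lookup es e) ≡ v → e ∈ incidentEdges es v
  ∈-incidentEdges (p ∷ ps) {v} zero e∋v with proj₁ p ≟ v | proj₂ p ≟ v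
  ... | yes _ | _     = here refl
  ... | no _  | yes _ = here refl
  ... | no s≢v | no t≢v = contradiction e∋v λ { (inj₁ s≡v) → s≢v s≡v ; (inj₂ t≡v) → t≢v t≡v }
  ∈-incidentEdges (p ∷ ps) {v} (suc e) e∋v with does (proj₁ p ≟ v) ∨ does (proj₂ p ≟ v)
  ... | true  = there (∈-map⁺ suc (∈-incidentEdges ps e e∋v))
  ... | false = ∈-map⁺ suc (∈-incidentEdges ps e e∋v)

module _ (G : RawGraph) where

  private
    ≡-components : ∀ {x y} {p : Fin (order G) × Fin (order G)} → (x , y) ≡ p → proj₁ p ≡ x × proj₂ p ≡ y
    ≡-components refl = refl , refl

  adj⇒joins : ∀ {x y} → Adj G x y → ∃[ e ] Joins G e x y
  adj⇒joins (inj₁ xy∈E) = index xy∈E , inj₁ (≡-components (lookup-index xy∈E))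
  adj⇒joins (inj₂ yx∈E) = index yx∈E , inj₂ (≡-components (lookup-index yx∈E))

  edge-adj : ∀ e → Adj G (src G e) (tgt G e)
  edge-adj e = inj₁ (∈-lookup e)

  adj-sym : ∀ {x y} → Adj G x y → Adj G y x
  adj-sym (inj₁ xy∈E) = inj₂ xy∈E
  adj-sym (inj₂ yx∈E) = inj₁ yx∈E

  joins-sym : ∀ {e x y} → Joins G e x y → Joins G e y x
  joins-sym (inj₁ e∼) = inj₂ e∼
  joins-sym (inj₂ e∼) = inj₁ e∼

  joins⇒incident : ∀ {e x y} → Joins G e x y → Incident G e x
  joins⇒incident (inj₁ (s≡x , _)) = inj₁ s≡x
  joins⇒incident (inj₂ (_ , t≡x)) = inj₂ t≡x

  joins-functional : ∀ {e x y y′} → Joins G e x y → Joins G e x y′ → y ≡ y′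
  joins-functional (inj₁ (_ , t≡y))   (inj₁ (_ , t≡y′))    = trans (sym t≡y) t≡y′
  joins-functional (inj₁ (s≡x , t≡y)) (inj₂ (s≡y′ , t≡x)) = trans (sym t≡y) (trans t≡x (trans (sym s≡x) s≡y′))
  joins-functional (inj₂ (s≡y , t≡x)) (inj₁ (s≡x , t≡y′)) = trans (sym s≡y) (trans s≡x (trans (sym t≡x) t≡y′))
  joins-functional (inj₂ (s≡y , _))   (inj₂ (s≡y′ , _))    = trans (sym s≡y) s≡y′

  joins-injective : Simple G → ∀ {e e′ x y} → Joins G e x y → Joins G e′ x y → e ≡ e′
  joins-injective (_ , no-parallel) {e} {e′} e∼ e′∼ =
    decidable-stable (e ≟ e′) λ e≢e′ → no-parallel e e′ e≢e′ (endpoints e′∼)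
    where
    e∋ : ∀ {z} → z ≡ _ ⊎ z ≡ _ → Incident G e z
    e∋ (inj₁ refl) = joins⇒incident e∼
    e∋ (inj₂ refl) = joins⇒incident (joins-sym e∼)
    endpoints : Joins G e′ _ _ → Incident G e (src G e′) × Incident G e (tgt G e′)
    endpoints (inj₁ (s≡x , t≡y)) = e∋ (inj₁ s≡x) , e∋ (inj₂ t≡y)
    endpoints (inj₂ (s≡y , t≡x)) = e∋ (inj₂ s≡y) , e∋ (inj₁ t≡x)

  degree≤maxDegree : ∀ v → degree G v ≤ maxDegree G
  degree≤maxDegree v = ∈⇒≤foldr-⊔ (∈-tabulate⁺ v)

  length-incidentEdges≤maxDegree : ∀ v → length (incidentEdges (edges G) v) ≤ maxDegree G
  length-incidentEdges≤maxDegree v = ≤-trans (≤-reflexive (length-incidentEdges (edges G) v)) (degree≤maxDegree v)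

  neighbours≤maxDegree : ∀ {x ys} → Unique ys → (∀ {y} → y ∈ ys → Adj G x y) → length ys ≤ maxDegree G
  neighbours≤maxDegree {x} {ys} ys-unique adjacent = begin
    length ys                          ≡⟨ length-tabulate edgeTo ⟨
    length (tabulate edgeTo)           ≤⟨ Unique-⊆⇒length≤ (Unique.tabulate⁺ edgeTo-injective) ⊆incident ⟩
    length (incidentEdges (edges G) x) ≤⟨ length-incidentEdges≤maxDegree x ⟩
    maxDegree G                        ∎
    where
    open Data.Nat.Properties.≤-Reasoning
    edgeTo : Fin (length ys) → Edge G
    edgeTo i = proj₁ (adj⇒joins (adjacent (∈-lookup i)))
    edgeTo-injective : ∀ {i j} → edgeTo i ≡ edgeTo j → i ≡ j
    edgeTo-injective {i} {j} eq = Unique⇒lookup-injective ys-unique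
      (joins-functional (proj₂ (adj⇒joins (adjacent (∈-lookup i))))
                        (subst (λ e → Joins G e x _) (sym eq) (proj₂ (adj⇒joins (adjacent (∈-lookup j))))))
    ⊆incident : ∀ {e} → e ∈ tabulate edgeTo → e ∈ incidentEdges (edges G) x
    ⊆incident e∈ with i , refl ← ∈-tabulate⁻ e∈ =
      ∈-incidentEdges (edges G) _ (joins⇒incident (proj₂ (adj⇒joins (adjacent (∈-lookup i)))))

module _ {B : Set} where

  triples : ∀ {m} → (Fin m → Fin 3 → B) → List B
  triples f = concat (tabulate (λ k → tabulate (f k)))

  position : ∀ {m} (f : Fin m → Fin 3 → B) → Fin m × Fin 3 → Fin (length (triples f))
  position {suc m} f (zero  , 0F) = 0F
  position {suc m} f (zero  , 1F) = 1F
  position {suc m} f (zero  , 2F) = 2F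
  position {suc m} f (suc k , j)  = suc (suc (suc (position (f ∘ suc) (k , j))))

  component : ∀ {m} (f : Fin m → Fin 3 → B) → Fin (length (triples f)) → Fin m × Fin 3
  component {suc m} f 0F                  = zero , 0F
  component {suc m} f 1F                  = zero , 1F
  component {suc m} f 2F                  = zero , 2F
  component {suc m} f (suc (suc (suc i))) = Product.map₁ suc (component (f ∘ suc) i)

  lookup-position : ∀ {m} (f : Fin m → Fin 3 → B) k j → lookup (triples f) (position f (k , j)) ≡ f k j
  lookup-position {suc m} f zero    0F = refl
  lookup-position {suc m} f zero    1F = refl
  lookup-position {suc m} f zero    2F = refl
  lookup-position {suc m} f (suc k) j  = lookup-position (f ∘ suc) k j

  position-component : ∀ {m} (f : Fin m → Fin 3 → B) i → position f (component f i) ≡ i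
  position-component {suc m} f 0F                  = refl
  position-component {suc m} f 1F                  = refl
  position-component {suc m} f 2F                  = refl
  position-component {suc m} f (suc (suc (suc i))) = cong (λ i → suc (suc (suc i))) (position-component (f ∘ suc) i)

  component-position : ∀ {m} (f : Fin m → Fin 3 → B) kj → component f (position f kj) ≡ kj
  component-position {suc m} f (zero  , 0F) = refl
  component-position {suc m} f (zero  , 1F) = refl
  component-position {suc m} f (zero  , 2F) = refl
  component-position {suc m} f (suc k , j)  = cong (Product.map₁ suc) (component-position (f ∘ suc) (k , j))

↑ˡ≢↑ʳ : ∀ {m n} (i : Fin m) (j : Fin n) → i ↑ˡ n ≢ m ↑ʳ j
↑ˡ≢↑ʳ {m} {n} i j eq = contradiction
  (trans (sym (Fin.splitAt-↑ˡ m i n)) (trans (cong (splitAt m) eq) (Fin.splitAt-↑ʳ m n j))) λ ()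

module _ (G : RawGraph) where
  private
    n = order G
    m = length (edges G)
    V̂ = Fin (order (hat G))

  vv : Fin n → V̂
  vv i = i ↑ˡ suc m

  ww : Edge G → V̂
  ww k = n ↑ʳ Fin.inject₁ k

  uu : V̂
  uu = n ↑ʳ Fin.fromℕ m

  hatEnds : Edge G → Fin 3 → V̂ × V̂
  hatEnds k 0F = vv (src G k) , ww k
  hatEnds k 1F = vv (tgt G k) , ww k
  hatEnds k 2F = uu , ww k

  -- edges (hat G) is triples hatEnds by definition
  hatEdge : Edge G → Fin 3 → Edge (hat G)
  hatEdge k j = position hatEnds (k , j)

  hatEdge-injectiveˡ : ∀ {k k′ j} → hatEdge k j ≡ hatEdge k′ j → k ≡ k′
  hatEdge-injectiveˡ {k} {k′} {j} eq =
    cong proj₁ (trans (sym (component-position hatEnds (k , j)))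
               (trans (cong (component hatEnds) eq) (component-position hatEnds (k′ , j))))

  ends-hatEdge : ∀ k j → ends (hat G) (hatEdge k j) ≡ hatEnds k j
  ends-hatEdge k j = lookup-position hatEnds k j

  vv-injective : ∀ {x y} → vv x ≡ vv y → x ≡ y
  vv-injective = Fin.↑ˡ-injective (suc m) _ _

  ww-injective : ∀ {k k′} → ww k ≡ ww k′ → k ≡ k′
  ww-injective = Fin.inject₁-injective ∘ Fin.↑ʳ-injective n _ _

  vv≢ww : ∀ {x k} → vv x ≢ ww k
  vv≢ww = ↑ˡ≢↑ʳ _ _

  vv≢uu : ∀ {x} → vv x ≢ uu
  vv≢uu = ↑ˡ≢↑ʳ _ _

  uu≢ww : ∀ {k} → uu ≢ ww k
  uu≢ww = Fin.fromℕ≢inject₁ ∘ Fin.↑ʳ-injective n _ _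

  private
    Touches : V̂ × V̂ → V̂ → Set
    Touches p v = proj₁ p ≡ v ⊎ proj₂ p ≡ v

    touches⇒incident : ∀ {k j v} → Touches (hatEnds k j) v → Incident (hat G) (hatEdge k j) v
    touches⇒incident {k} {j} = subst (λ p → Touches p _) (sym (ends-hatEdge k j))

    incident⇒touches : ∀ {k j v} → Incident (hat G) (hatEdge k j) v → Touches (hatEnds k j) v
    incident⇒touches {k} {j} = subst (λ p → Touches p _) (ends-hatEdge k j)

    as-hatEdge : ∀ e → ∃[ k ] ∃[ j ] hatEdge k j ≡ e
    as-hatEdge e = proj₁ (component hatEnds e) , proj₂ (component hatEnds e) , position-component hatEnds e

  hatEdge∋ww : ∀ k j → Incident (hat G) (hatEdge k j) (ww k)
  hatEdge∋ww k j = touches⇒incident {j = j} (inj₂ (second-end j))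
    where
    second-end : ∀ j → proj₂ (hatEnds k j) ≡ ww k
    second-end 0F = refl
    second-end 1F = refl
    second-end 2F = refl

  hatEdge∋uu : ∀ k → Incident (hat G) (hatEdge k 2F) uu
  hatEdge∋uu k = touches⇒incident (inj₁ refl)

  hatEdge∋vv-src : ∀ k → Incident (hat G) (hatEdge k 0F) (vv (src G k))
  hatEdge∋vv-src k = touches⇒incident (inj₁ refl)

  hatEdge∋vv : ∀ {k x} → Incident G k x → ∃[ j ] Incident (hat G) (hatEdge k j) (vv x)
  hatEdge∋vv (inj₁ refl) = 0F , hatEdge∋vv-src _
  hatEdge∋vv (inj₂ refl) = 1F , touches⇒incident (inj₁ refl)

  incident-ww : ∀ {e k} → Incident (hat G) e (ww k) → ∃[ j ] hatEdge k j ≡ e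
  incident-ww {e} {k} e∋ with as-hatEdge e
  ... | k′ , j , refl = j , cong (λ k → hatEdge k j) (sym (touches-ww j (incident⇒touches e∋)))
    where
    touches-ww : ∀ j → Touches (hatEnds k′ j) (ww k) → k′ ≡ k
    touches-ww 0F (inj₁ vv≡ww) = contradiction vv≡ww vv≢ww
    touches-ww 1F (inj₁ vv≡ww) = contradiction vv≡ww vv≢ww
    touches-ww 2F (inj₁ uu≡ww) = contradiction uu≡ww uu≢ww
    touches-ww 0F (inj₂ ww≡ww) = ww-injective ww≡ww
    touches-ww 1F (inj₂ ww≡ww) = ww-injective ww≡ww
    touches-ww 2F (inj₂ ww≡ww) = ww-injective ww≡ww

  incident-vv : ∀ {e x} → Incident (hat G) e (vv x) →
    ∃[ k ] ((hatEdge k 0F ≡ e × src G k ≡ x) ⊎ (hatEdge k 1F ≡ e × tgt G k ≡ x))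
  incident-vv {e} {x} e∋ with as-hatEdge e
  ... | k , j , refl = k , touches-vv j (incident⇒touches e∋)
    where
    touches-vv : ∀ j → Touches (hatEnds k j) (vv x) →
      (hatEdge k 0F ≡ hatEdge k j × src G k ≡ x) ⊎ (hatEdge k 1F ≡ hatEdge k j × tgt G k ≡ x)
    touches-vv 0F (inj₁ vv≡vv) = inj₁ (refl , vv-injective vv≡vv)
    touches-vv 1F (inj₁ vv≡vv) = inj₂ (refl , vv-injective vv≡vv)
    touches-vv 2F (inj₁ uu≡vv) = contradiction (sym uu≡vv) vv≢uu
    touches-vv 0F (inj₂ ww≡vv) = contradiction (sym ww≡vv) vv≢ww
    touches-vv 1F (inj₂ ww≡vv) = contradiction (sym ww≡vv) vv≢ww
    touches-vv 2F (inj₂ ww≡vv) = contradiction (sym ww≡vv) vv≢ww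

  positionAt : Fin n → Edge G → Fin 3
  positionAt x k = if does (src G k ≟ x) then 0F else 1F

  edgesAt-vv : Fin n → List (Edge (hat G))
  edgesAt-vv x = map (λ k → hatEdge k (positionAt x k)) (incidentEdges (edges G) x)

  ∈-edgesAt-vv : Simple G → ∀ {e x} → Incident (hat G) e (vv x) → e ∈ edgesAt-vv x
  ∈-edgesAt-vv simple {e} {x} e∋ with incident-vv e∋
  ... | k , inj₁ (refl , src≡x) = subst (λ j → hatEdge k j ∈ edgesAt-vv x) (positionAt-src src≡x)
          (∈-map⁺ (λ k → hatEdge k (positionAt x k)) (∈-incidentEdges (edges G) k (inj₁ src≡x)))
    where
    positionAt-src : src G k ≡ x → positionAt x k ≡ 0F
    positionAt-src src≡x with src G k ≟ x
    ... | yes _ = refl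
    ... | no src≢x = contradiction src≡x src≢x
  ... | k , inj₂ (refl , tgt≡x) = subst (λ j → hatEdge k j ∈ edgesAt-vv x) (positionAt-tgt tgt≡x)
          (∈-map⁺ (λ k → hatEdge k (positionAt x k)) (∈-incidentEdges (edges G) k (inj₂ tgt≡x)))
    where
    positionAt-tgt : tgt G k ≡ x → positionAt x k ≡ 1F
    positionAt-tgt tgt≡x with src G k ≟ x
    ... | yes src≡x = contradiction (trans src≡x (sym tgt≡x)) (proj₁ simple k)
    ... | no _ = refl

-- Colours along walks in Ĝ

-- With at most d added integers, the colours at v_x (at most Δ of them), resp. at w_e (three),
-- lie in a cyclic interval of at most Δ + d, resp. 3 + d, integers.
spanV : RawGraph → ℕ → ℕ
spanV G d = maxDegree G + d ∸ 1

spanW : ℕ → ℕ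
spanW d = 2 + d

module _ (G : RawGraph) (simple : Simple G) {t d : ℕ} {α : Edge (hat G) → ℕ} {ks : Fin (order (hat G)) → ℕ}
         (deficiency : ∀ v → IsVertexDeficiency (hat G) t α v (ks v)) (ks≤d : ∀ v → ks v ≤ d) where
  private
    sv = spanV G d
    sw = spanW d

  near-at-vv : ∀ {x e f} → Incident (hat G) e (vv G x) → Incident (hat G) f (vv G x) → Near t sv (α e) (α f)
  near-at-vv {x} e∋ f∋ =
    near-mono (∸-monoˡ-≤ 1 (+-mono-≤ length≤Δ (ks≤d (vv G x))))
      (near-at-vertex {hat G} (edgesAt-vv G x) (∈-edgesAt-vv G simple) (deficiency (vv G x)) e∋ f∋)
    where
    length≤Δ : length (edgesAt-vv G x) ≤ maxDegree G
    length≤Δ = ≤-trans (≤-reflexive (length-map _ (incidentEdges (edges G) x))) (length-incidentEdges≤maxDegree G x)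

  near-at-ww : ∀ {k e f} → Incident (hat G) e (ww G k) → Incident (hat G) f (ww G k) → Near t sw (α e) (α f)
  near-at-ww {k} e∋ f∋ =
    near-mono (+-monoʳ-≤ 2 (ks≤d (ww G k)))
      (near-at-vertex {hat G} (tabulate (hatEdge G k)) ∈-edgesAt-ww (deficiency (ww G k)) e∋ f∋)
    where
    ∈-edgesAt-ww : ∀ {e} → Incident (hat G) e (ww G k) → e ∈ tabulate (hatEdge G k)
    ∈-edgesAt-ww e∋ with j , refl ← incident-ww G e∋ = ∈-tabulate⁺ {f = hatEdge G k} j

  -- a walk of length k in G becomes a path in Ĝ alternating between v- and w-vertices
  near-along-walk : ∀ {x y k e f} → Walk G x y k → Incident (hat G) e (vv G x) → Incident (hat G) f (vv G y) →
    Near t (k * (sv + sw) + sv) (α e) (α f)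
  near-along-walk nil e∋ f∋ = near-at-vv e∋ f∋
  near-along-walk {k = suc k} {e} {f} (cons x~z walk) e∋ f∋ =
    subst (λ r → Near t r (α e) (α f)) (sym (+-assoc (sv + sw) (k * (sv + sw)) sv))
      (near-trans (near-trans (near-at-vv e∋ (proj₂ g∋x)) (near-at-ww (hatEdge∋ww G g _) (hatEdge∋ww G g _)))
                  (near-along-walk walk (proj₂ g∋z) f∋))
    where
    g = proj₁ (adj⇒joins G x~z)
    g-joins = proj₂ (adj⇒joins G x~z)
    g∋x = hatEdge∋vv G (joins⇒incident G g-joins)
    g∋z = hatEdge∋vv G (joins⇒incident G (joins-sym G g-joins))

  edges≤-by-colours : ∀ {D} → IsProperColoring (hat G) t α → (∀ x y → ∃[ k ] (k ≤ D × Walk G x y k)) → Edge G →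
    length (edges G) ≤ 2 * suc (sw + (D * (sv + sw) + sv) + sw)
  edges≤-by-colours {D} (colours-in-range , proper) walks e₀ =
    near-distinct≤ apexColour (λ k → colours-in-range (hatEdge G k 2F)) apexColour-injective near-e₀
    where
    apexColour : Edge G → ℕ
    apexColour k = α (hatEdge G k 2F)
    apexColour-injective : ∀ {k k′} → apexColour k ≡ apexColour k′ → k ≡ k′
    apexColour-injective {k} {k′} eq = decidable-stable (k ≟ k′) λ k≢k′ →
      proper _ _ (uu G) (k≢k′ ∘ hatEdge-injectiveˡ G) (hatEdge∋uu G k) (hatEdge∋uu G k′) eq
    near-e₀ : ∀ f → Near t (sw + (D * (sv + sw) + sv) + sw) (apexColour e₀) (apexColour f)
    near-e₀ f with k , k≤D , walk ← walks (src G e₀) (src G f) =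
      near-mono (+-monoˡ-≤ sw (+-monoʳ-≤ sw (+-monoˡ-≤ sv (*-monoˡ-≤ (sv + sw) k≤D))))
        (near-trans (near-trans (near-at-ww (hatEdge∋ww G e₀ 2F) (hatEdge∋ww G e₀ 0F))
                                (near-along-walk walk (hatEdge∋vv-src G e₀) (hatEdge∋vv-src G f)))
                    (near-at-ww (hatEdge∋ww G f 0F) (hatEdge∋ww G f 2F)))

-- Non-backtracking walks

module _ (G : RawGraph) where
  private
    V = Fin (order G)

  -- NBWalk a p y k: a walk a → ⋯ → p → y of length k ≥ 1 that never steps back to the vertex it came from
  data NBWalk (a : V) : V → V → ℕ → Set where
    start : ∀ {y} → Adj G a y → NBWalk a a y 1
    step  : ∀ {p y z k} → NBWalk a p y k → Adj G y z → p ≢ z → NBWalk a y z (suc k)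

  -- what remains of a walk from a after cancelling its backtracks
  data Reduced (a : V) : V → ℕ → Set where
    empty    : Reduced a a 0
    nonempty : ∀ {p y k} → NBWalk a p y k → Reduced a y k

  record EndingWalk (a : V) (e : Edge G) : Set where
    constructor endingWalk
    field
      {prev last} : V
      {len}       : ℕ
      joins       : Joins G e prev last
      walk        : NBWalk a prev last len

  module _ {a : V} where

    NBWalk-length≥1 : ∀ {p y k} → NBWalk a p y k → 1 ≤ k
    NBWalk-length≥1 (start _)    = s≤s z≤n
    NBWalk-length≥1 (step _ _ _) = s≤s z≤n

    lastStep : ∀ {p y k} → NBWalk a p y k → Adj G p y
    lastStep (start a~y)    = a~y
    lastStep (step _ y~z _) = y~z

    firstEdge : ∀ {p y k} → NBWalk a p y k → Edge G
    firstEdge (start a~y)  = proj₁ (adj⇒joins G a~y)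
    firstEdge (step w _ _) = firstEdge w

    firstEdge∋a : ∀ {p y k} (w : NBWalk a p y k) → Incident G (firstEdge w) a
    firstEdge∋a (start a~y)  = joins⇒incident G (proj₂ (adj⇒joins G a~y))
    firstEdge∋a (step w _ _) = firstEdge∋a w

    push : ∀ {y z k} → Reduced a y k → Adj G y z → ∃[ k′ ] (k′ ≤ suc k × Reduced a z k′)
    push empty y~z = 1 , ≤-refl , nonempty (start y~z)
    push {z = z} {k} (nonempty {p} w) y~z with p ≟ z
    ... | no p≢z  = suc k , ≤-refl , nonempty (step w y~z p≢z)
    ... | yes refl = backtrack w
      where
      backtrack : ∀ {p y k} → NBWalk a p y k → ∃[ k′ ] (k′ ≤ suc k × Reduced a p k′)
      backtrack (start _)              = 0 , z≤n , empty
      backtrack (step {k = k′} w′ _ _) = k′ , m≤n⇒m≤1+n (n≤1+n k′) , nonempty w′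

    reduce : ∀ {x z k l} → Reduced a x k → Walk G x z l → ∃[ k′ ] (k′ ≤ k + l × Reduced a z k′)
    reduce {k = k} r nil = k , m≤m+n k 0 , r
    reduce {k = k} {suc l} r (cons x~y walk) =
      let k₁ , k₁≤ , r₁ = push r x~y
          k₂ , k₂≤ , r₂ = reduce r₁ walk
      in k₂ , ≤-trans k₂≤ (≤-trans (+-monoˡ-≤ l k₁≤) (≤-reflexive (sym (+-suc k l)))) , r₂

    endingWalk-from : ∀ {x k} e → src G e ≡ x → Reduced a x k → Σ[ w ∈ EndingWalk a e ] EndingWalk.len w ≤ suc k
    endingWalk-from e refl empty = endingWalk (inj₁ (refl , refl)) (start (edge-adj G e)) , ≤-refl
    endingWalk-from {k = k} e refl (nonempty {p} w) with p ≟ tgt G e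
    ... | yes refl = endingWalk (inj₂ (refl , refl)) w , n≤1+n k
    ... | no p≢tgt = endingWalk (inj₁ (refl , refl)) (step w (edge-adj G e) p≢tgt) , ≤-refl

    endingWalks : ∀ {D} → (∀ y → ∃[ k ] (k ≤ D × Walk G a y k)) →
      ∀ e → Σ[ w ∈ EndingWalk a e ] EndingWalk.len w ≤ suc D
    endingWalks walks e =
      let k , k≤D , walk = walks (src G e)
          k′ , k′≤k , r = reduce empty walk
          w , len≤ = endingWalk-from e refl r
      in w , ≤-trans len≤ (s≤s (≤-trans k′≤k k≤D))

    NBWalk-determined : maxDegree G ≤ 2 → ∀ {p y k p′ y′ k′} (w : NBWalk a p y k) (w′ : NBWalk a p′ y′ k′) →
      k ≡ k′ → firstEdge w ≡ firstEdge w′ → p ≡ p′ × y ≡ y′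
    NBWalk-determined Δ≤2 (start a~y) (start a~y′) _ first≡ = refl , joins-functional G (proj₂ (adj⇒joins G a~y))
      (subst (λ e → Joins G e a _) (sym first≡) (proj₂ (adj⇒joins G a~y′)))
    NBWalk-determined Δ≤2 (start _) (step w′ _ _) 1≡ _ =
      contradiction (suc-injective 1≡) (<⇒≢ (NBWalk-length≥1 w′))
    NBWalk-determined Δ≤2 (step w _ _) (start _) ≡1 _ =
      contradiction (sym (suc-injective ≡1)) (<⇒≢ (NBWalk-length≥1 w))
    NBWalk-determined Δ≤2 (step {p} w y~z p≢z) (step w′ y~z′ p≢z′) k≡k′ first≡
      with NBWalk-determined Δ≤2 w w′ (suc-injective k≡k′) first≡
    ... | refl , refl with _ ≟ _
    ...   | yes z≡z′ = refl , z≡z′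
    ...   | no z≢z′ = contradiction three≤Δ (≤⇒≯ Δ≤2)
      where
      three≤Δ : 3 ≤ maxDegree G
      three≤Δ = neighbours≤maxDegree G (((p≢z ∷ p≢z′ ∷ []) ∷ (z≢z′ ∷ []) ∷ [] ∷ []))
        λ { (here refl) → adj-sym G (lastStep w) ; (there (here refl)) → y~z ; (there (there (here refl))) → y~z′ }

    NBWalk-length≡1 : maxDegree G ≤ 1 → ∀ {p y k} → NBWalk a p y k → k ≡ 1
    NBWalk-length≡1 Δ≤1 (start _) = refl
    NBWalk-length≡1 Δ≤1 (step w y~z p≢z) = contradiction two≤Δ (≤⇒≯ Δ≤1)
      where
      two≤Δ : 2 ≤ maxDegree G
      two≤Δ = neighbours≤maxDegree G ((p≢z ∷ []) ∷ [] ∷ [])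
        λ { (here refl) → adj-sym G (lastStep w) ; (there (here refl)) → y~z }

    -- an edge is recovered from the length and first edge of a walk ending along it
    edges≤-by-endingWalks : Simple G → maxDegree G ≤ 2 → ∀ {K} (ending : ∀ e → EndingWalk a e) →
      (∀ e → EndingWalk.len (ending e) ≤ K) → length (edges G) ≤ K * maxDegree G
    edges≤-by-endingWalks simple Δ≤2 {K} ending len≤K = begin
      length (edges G)                   ≡⟨ length-tabulate code ⟨
      length (tabulate code)             ≤⟨ Unique-⊆⇒length≤ (Unique.tabulate⁺ code-injective) ⊆codes ⟩
      length codes                       ≡⟨ length-cartesianProduct (applyUpTo suc K) (incidentEdges (edges G) a) ⟩
      length (applyUpTo suc K) * length (incidentEdges (edges G) a)
                                         ≤⟨ *-mono-≤ (≤-reflexive (length-applyUpTo suc K)) (length-incidentEdges≤maxDegree G a) ⟩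
      K * maxDegree G                    ∎
      where
      open ≤-Reasoning
      open EndingWalk
      codes = cartesianProduct (applyUpTo suc K) (incidentEdges (edges G) a)
      code : Edge G → ℕ × Edge G
      code e = len (ending e) , firstEdge (walk (ending e))
      code-injective : ∀ {e e′} → code e ≡ code e′ → e ≡ e′
      code-injective {e} {e′} code≡ =
        let prev≡ , last≡ = NBWalk-determined Δ≤2 (walk (ending e)) (walk (ending e′))
                                              (cong proj₁ code≡) (cong proj₂ code≡)
        in joins-injective G simple (joins (ending e))
             (subst₂ (Joins G e′) (sym prev≡) (sym last≡) (joins (ending e′)))
      ⊆codes : ∀ {c} → c ∈ tabulate code → c ∈ codes
      ⊆codes c∈ with e , refl ← ∈-tabulate⁻ c∈ =
        ∈-cartesianProduct⁺ (∈-1…K (NBWalk-length≥1 (walk (ending e))) (len≤K e))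
                            (∈-incidentEdges (edges G) _ (firstEdge∋a (walk (ending e))))
        where
        ∈-1…K : ∀ {k} → 1 ≤ k → k ≤ K → k ∈ applyUpTo suc K
        ∈-1…K (s≤s z≤n) k≤K = ∈-applyUpTo⁺ suc k≤K

walk⇒neighbour : ∀ {G x y k} → x ≢ y → Walk G x y k → ∃[ z ] Adj G x z
walk⇒neighbour x≢y nil          = contradiction refl x≢y
walk⇒neighbour _   (cons x~z _) = _ , x~z

connected⇒neighbour : ∀ {G} → Connected G → 2 ≤ order G → ∃[ x ] ∃[ z ] Adj G x z
connected⇒neighbour connected 2≤n = x , walk⇒neighbour x≢y (proj₂ (connected x y))
  where
  x = fromℕ< (≤-trans (s≤s z≤n) 2≤n)
  y = fromℕ< 2≤n
  x≢y : x ≢ y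
  x≢y x≡y = 0≢1+n (trans (sym (Fin.toℕ-fromℕ< _)) (trans (cong toℕ x≡y) (Fin.toℕ-fromℕ< 2≤n)))

module _ {m : ℕ} (D d : ℕ) where
  open ≤-Reasoning

  deficiency-inequality-Δ≡1 : ∀ {Δ} → 1 ≤ Δ → Δ ≤ 1 → m ≤ 1 * Δ →
    m ∸ 1 + 4 * (D + 2) ≤ 4 * (D + 2) * (d + Δ)
  deficiency-inequality-Δ≡1 (s≤s z≤n) (s≤s z≤n) m≤1 = begin
    m ∸ 1 + 4 * (D + 2)   ≡⟨ cong (_+ 4 * (D + 2)) (m≤n⇒m∸n≡0 m≤1) ⟩
    4 * (D + 2)           ≡⟨ *-identityʳ (4 * (D + 2)) ⟨
    4 * (D + 2) * 1       ≤⟨ *-monoʳ-≤ (4 * (D + 2)) (m≤n+m 1 d) ⟩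
    4 * (D + 2) * (d + 1) ∎

  deficiency-inequality-Δ≡2 : ∀ {Δ} → 2 ≤ Δ → Δ ≤ 2 → m ≤ suc D * Δ →
    m ∸ 1 + 4 * (D + 2) ≤ 4 * (D + 2) * (d + Δ)
  deficiency-inequality-Δ≡2 (s≤s (s≤s z≤n)) (s≤s (s≤s z≤n)) m≤ = begin
    m ∸ 1 + 4 * (D + 2)                   ≤⟨ +-monoˡ-≤ (4 * (D + 2)) (≤-trans (m∸n≤m m 1) m≤) ⟩
    suc D * 2 + 4 * (D + 2)               ≤⟨ m≤m+n _ (2 * D + 6) ⟩
    suc D * 2 + 4 * (D + 2) + (2 * D + 6) ≡⟨ identity D ⟩
    4 * (D + 2) * 2                       ≤⟨ *-monoʳ-≤ (4 * (D + 2)) (m≤n+m 2 d) ⟩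
    4 * (D + 2) * (d + 2)                 ∎
    where
    identity : ∀ D → suc D * 2 + 4 * (D + 2) + (2 * D + 6) ≡ 4 * (D + 2) * 2
    identity = solve-∀

  deficiency-inequality-Δ≥3 : ∀ {Δ} → 3 ≤ Δ →
    m ≤ 2 * suc ((2 + d) + (D * ((Δ + d ∸ 1) + (2 + d)) + (Δ + d ∸ 1)) + (2 + d)) →
    m ∸ 1 + 4 * (D + 2) ≤ 4 * (D + 2) * (d + Δ)
  deficiency-inequality-Δ≥3 (s≤s (s≤s (s≤s {n = δ} z≤n))) m≤ = begin
    m ∸ 1 + 4 * (D + 2)             ≤⟨ +-monoˡ-≤ (4 * (D + 2)) (≤-trans (m∸n≤m m 1) m≤) ⟩
    2 * suc R + 4 * (D + 2)         ≤⟨ m≤m+n _ slack ⟩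
    2 * suc R + 4 * (D + 2) + slack ≡⟨ identity δ d D ⟩
    4 * (D + 2) * (d + (3 + δ))     ∎
    where
    R = (2 + d) + (D * ((2 + δ + d) + (2 + d)) + (2 + δ + d)) + (2 + d)
    slack = 2 * d + 2 + 2 * δ + 2 * (D + 2) * δ
    identity : ∀ δ d D → let sv = 2 + δ + d ; sw = 2 + d in
      2 * suc (sw + (D * (sv + sw) + sv) + sw) + 4 * (D + 2) + (2 * d + 2 + 2 * δ + 2 * (D + 2) * δ)
        ≡ 4 * (D + 2) * (d + (3 + δ))
    identity = solve-∀

theorem8 : (G : RawGraph) → Simple G → Connected G → 2 ≤ order G →
    (D d : ℕ) → IsDiameter G D → IsCyclicDeficiency (hat G) d →
    (length (edges G) ∸ 1) + 4 * (D + 2) ≤ 4 * (D + 2) * (d + maxDegree G)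
theorem8 G simple connected 2≤n D d (walks , _) ((t , α , proper , ks , deficiency , Σks≡d) , _) =
  by-degree (maxDegree G ≤? 1) (maxDegree G ≤? 2)
  where
  neighbour = connected⇒neighbour connected 2≤n
  a = proj₁ neighbour
  a~z = proj₂ (proj₂ neighbour)
  1≤Δ : 1 ≤ maxDegree G
  1≤Δ = neighbours≤maxDegree G ([] ∷ []) λ { (here refl) → a~z }
  ks≤d : ∀ v → ks v ≤ d
  ks≤d v = subst (ks v ≤_) Σks≡d (∈⇒≤sum (∈-tabulate⁺ v))
  ending : ∀ e → EndingWalk G a e
  ending e = proj₁ (endingWalks G (walks a) e)
  by-degree : Dec (maxDegree G ≤ 1) → Dec (maxDegree G ≤ 2) →
    length (edges G) ∸ 1 + 4 * (D + 2) ≤ 4 * (D + 2) * (d + maxDegree G)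
  by-degree (yes Δ≤1) _ = deficiency-inequality-Δ≡1 D d 1≤Δ Δ≤1
    (edges≤-by-endingWalks G simple (≤-trans Δ≤1 (n≤1+n 1)) ending
      (λ e → ≤-reflexive (NBWalk-length≡1 G Δ≤1 (EndingWalk.walk (ending e)))))
  by-degree (no Δ≰1) (yes Δ≤2) = deficiency-inequality-Δ≡2 D d (≰⇒> Δ≰1) Δ≤2
    (edges≤-by-endingWalks G simple Δ≤2 ending (proj₂ ∘ endingWalks G (walks a)))
  by-degree (no _) (no Δ≰2) = deficiency-inequality-Δ≥3 D d (≰⇒> Δ≰2)
    (edges≤-by-colours G simple deficiency ks≤d proper walks (proj₁ (adj⇒joins G a~z)))
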